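{- Let $\mathcal D$ be an $s$-bounded abstract system of proof notations, let $d,d'\in\mathrm{Ecl}(\mathcal D)$ with $d\to d'$ in $\mathrm{Ecl}(\mathcal D)$. Then $\vartheta_d(s)\ge\vartheta_{d'}(s)$.
   Context: An abstract system of proof notations is a set $\mathcal D$ together with two functions $|\cdot|,\|\cdot\|\colon\mathcal D\to\mathbb N\setminus\{0\}$ ("size" and "height") and a relation $\to\,\subseteq\mathcal D\times\mathcal D$ such that $d\to d'$ implies $\|d'\|<\|d\|$. $\mathcal D$ is $s$-bounded if $|d|\le s$ for all $d\in\mathcal D$. The cut elimination closure $\mathrm{Ecl}(\mathcal D)$ is defined inductively, with new symbols $\mathsf I,\mathsf R,\mathsf E$: every $d\in\mathcal D$ is in $\mathrm{Ecl}(\mathcal D)$ (with its size and height); if $d,e\in\mathrm{Ecl}(\mathcal D)$ then $\mathsf I d,\ \mathsf R de,\ \mathsf E d\in\mathrm{Ecl}(\mathcal D)$, with $|\mathsf I d|=|d|+1$, $|\mathsf R de|=|d|+|e|+1$, $|\mathsf E d|=|d|+1$, and $\|\mathsf I d\|=\|d\|$, $\|\mathsf R de\|=\|d\|+\|e\|$, $\|\mathsf E d\|=2^{\|d\|}-1$. The relation $\to$ on $\mathrm{Ecl}(\mathcal D)$ is inductively generated by: $d\to d'$ whenever this holds in $\mathcal D$; if $d\to d'$ then $\mathsf I d\to\mathsf I d'$ and $\mathsf E d\to\mathsf E d'$; if $e\to e'$ then $\mathsf R de\to\mathsf R de'$; $\mathsf R de\to\mathsf I d$ always; if $d\to d'$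 and $d\to d''$ then $\mathsf E d\to\mathsf R(\mathsf E d')(\mathsf E d'')$. Size functions: to each $d\in\mathrm{Ecl}(\mathcal D)$ a monotone function $\vartheta_d\colon\mathbb N\to\mathbb N$ is assigned by recursion: $\vartheta_d(s)=s$ for $d\in\mathcal D$; $\vartheta_{\mathsf I d}(s)=\vartheta_d(s)+1$; $\vartheta_{\mathsf R de}(s)=\max\{|d|+1+\vartheta_e(s),\ \vartheta_d(s)+1\}$; $\vartheta_{\mathsf E d}(s)=\|d\|\cdot(\vartheta_d(s)+2)$. -}

module Defs where

open import Level using (Level; suc; _⊔_)
open import Data.Nat using (ℕ; _+_; _*_; _∸_; _^_; _≤_; _<_; _⊔_)
open import Data.Nat as ℕ using ()

record ProofNotations (a r : Level) : Set (Level.suc (a Level.⊔ r)) where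
  field
    Carrier   : Set a
    size      : Carrier → ℕ
    height    : Carrier → ℕ
    size-pos   : ∀ d → 1 ≤ size d
    height-pos : ∀ d → 1 ≤ height d
    _⟶_       : Carrier → Carrier → Set r
    ⟶-height  : ∀ {d d'} → d ⟶ d' → height d' < height d

Bounded : ∀ {a r} → ProofNotations a r → ℕ → Set a
Bounded 𝒟 s = ∀ d → ProofNotations.size 𝒟 d ≤ s

module _ {a r} (𝒟 : ProofNotations a r) where
  open ProofNotations 𝒟

  data Ecl : Set a where
    base : Carrier → Ecl
    I    : Ecl → Ecl
    R    : Ecl → Ecl → Ecl
    E    : Ecl → Ecl

  eSize : Ecl → ℕ
  eSize (base d) = size d
  eSize (I d)    = eSize d ℕ.+ 1
  eSize (R d e)  = eSize d ℕ.+ eSize e ℕ.+ 1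
  eSize (E d)    = eSize d ℕ.+ 1

  eHeight : Ecl → ℕ
  eHeight (base d) = height d
  eHeight (I d)    = eHeight d
  eHeight (R d e)  = eHeight d ℕ.+ eHeight e
  eHeight (E d)    = 2 ℕ.^ eHeight d ℕ.∸ 1

  data _⇒_ : Ecl → Ecl → Set (a Level.⊔ r) where
    base⇒ : ∀ {d d'} → d ⟶ d' → base d ⇒ base d'
    I⇒    : ∀ {d d'} → d ⇒ d' → I d ⇒ I d'
    E⇒    : ∀ {d d'} → d ⇒ d' → E d ⇒ E d'
    R⇒    : ∀ {d e e'} → e ⇒ e' → R d e ⇒ R d e'
    RI⇒   : ∀ {d e} → R d e ⇒ I d
    ER⇒   : ∀ {d d' d''} → d ⇒ d' → d ⇒ d'' → E d ⇒ R (E d') (E d'')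

  ϑ : Ecl → ℕ → ℕ
  ϑ (base d) s = s
  ϑ (I d)    s = ϑ d s ℕ.+ 1
  ϑ (R d e)  s = (eSize d ℕ.+ 1 ℕ.+ ϑ e s) ℕ.⊔ (ϑ d s ℕ.+ 1)
  ϑ (E d)    s = eHeight d ℕ.* (ϑ d s ℕ.+ 2)

module Submission where

-- All congruence
-- cases follow from monotonicity of the operations defining ϑ, and the step
-- R d e ⇒ I d is immediate.  The only real case is E d ⇒ R (E d') (E d''),
-- which needs two auxiliary facts about Ecl(D):
--   * reductions strictly decrease heights (so ‖d'‖, ‖d''‖ < ‖d‖), which in
--     turn uses that all heights are positive; and
--   * for an s-bounded D, the size of every d is bounded by ϑ_d(s).
-- With these, writing ‖d‖ = 1 + k, both components of the maximum defining
-- ϑ of the reduct are bounded by (ϑ_d(s) + 2) + k·(ϑ_d(s) + 2) = ϑ_{E d}(s).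

open import Defs
open import Data.Nat using (ℕ; _≥_; suc; _+_; _*_; _∸_; _^_; _≤_; _<_; _⊔_; z≤n; s≤s)
open import Data.Nat.Properties
open import Relation.Binary.PropositionalEquality using (subst; cong)

pow-pred-< : ∀ {m n} → m < n → 2 ^ m ∸ 1 < 2 ^ n ∸ 1
pow-pred-< {m} m<n = ∸-monoˡ-< (^-monoʳ-< 2 (s≤s (s≤s z≤n)) m<n) (m^n>0 2 m)

pow-sum-≤ : ∀ {m₁ m₂ n} → m₁ < n → m₂ < n → 2 ^ m₁ + 2 ^ m₂ ≤ 2 ^ n
pow-sum-≤ (s≤s p) (s≤s q) =
  +-mono-≤ (^-monoʳ-≤ 2 p) (≤-trans (^-monoʳ-≤ 2 q) (m≤m+n _ 0))

pred-sum-< : ∀ {x y z} → 1 ≤ x → 1 ≤ y → x + y ≤ z → (x ∸ 1) + (y ∸ 1) < z ∸ 1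
pred-sum-< {suc x} {suc y} {suc z} _ _ (s≤s x+y<z) =
  subst (_≤ z) (+-suc x y) x+y<z

module Heights {a r} (𝒟 : ProofNotations a r) where
  open ProofNotations 𝒟

  eHeight-pos : ∀ d → 1 ≤ eHeight 𝒟 d
  eHeight-pos (base d) = height-pos d
  eHeight-pos (I d)    = eHeight-pos d
  eHeight-pos (R d e)  = ≤-trans (eHeight-pos d) (m≤m+n _ _)
  eHeight-pos (E d)    = pow-pred-< (eHeight-pos d)

  ⇒-height : ∀ {d d'} → _⇒_ 𝒟 d d' → eHeight 𝒟 d' < eHeight 𝒟 d
  ⇒-height (base⇒ p)          = ⟶-height p
  ⇒-height (I⇒ p)             = ⇒-height p
  ⇒-height (E⇒ p)             = pow-pred-< (⇒-height p)
  ⇒-height (R⇒ {d} p)         = +-monoʳ-< (eHeight 𝒟 d) (⇒-height p)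
  ⇒-height (RI⇒ {d} {e})      =
    subst (_< eHeight 𝒟 d + eHeight 𝒟 e) (+-identityʳ (eHeight 𝒟 d))
          (+-monoʳ-< (eHeight 𝒟 d) (eHeight-pos e))
  ⇒-height (ER⇒ {d' = d'} {d''} p q) =
    pred-sum-< (m^n>0 2 (eHeight 𝒟 d')) (m^n>0 2 (eHeight 𝒟 d''))
               (pow-sum-≤ (⇒-height p) (⇒-height q))

module SizeFunctions {a r} (𝒟 : ProofNotations a r) (s : ℕ) (bounded : Bounded 𝒟 s) where
  open Heights 𝒟

  eSize≤ϑ : ∀ d → eSize 𝒟 d ≤ ϑ 𝒟 d s
  eSize≤ϑ (base d) = bounded d
  eSize≤ϑ (I d)    = +-monoˡ-≤ 1 (eSize≤ϑ d)
  eSize≤ϑ (R d e)  = ≤-trans size≤left (m≤m⊔n _ _)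
    where
    size≤left : eSize 𝒟 d + eSize 𝒟 e + 1 ≤ eSize 𝒟 d + 1 + ϑ 𝒟 e s
    size≤left = begin
      eSize 𝒟 d + eSize 𝒟 e + 1   ≡⟨ +-assoc (eSize 𝒟 d) (eSize 𝒟 e) 1 ⟩
      eSize 𝒟 d + (eSize 𝒟 e + 1) ≡⟨ cong (eSize 𝒟 d +_) (+-comm (eSize 𝒟 e) 1) ⟩
      eSize 𝒟 d + (1 + eSize 𝒟 e) ≡⟨ +-assoc (eSize 𝒟 d) 1 (eSize 𝒟 e) ⟨
      eSize 𝒟 d + 1 + eSize 𝒟 e   ≤⟨ +-monoʳ-≤ (eSize 𝒟 d + 1) (eSize≤ϑ e) ⟩
      eSize 𝒟 d + 1 + ϑ 𝒟 e s     ∎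
      where open ≤-Reasoning
  eSize≤ϑ (E d)    = begin
    eSize 𝒟 d + 1               ≤⟨ +-monoʳ-≤ (eSize 𝒟 d) (s≤s z≤n) ⟩
    eSize 𝒟 d + 2               ≤⟨ +-monoˡ-≤ 2 (eSize≤ϑ d) ⟩
    ϑ 𝒟 d s + 2                 ≡⟨ *-identityˡ (ϑ 𝒟 d s + 2) ⟨
    1 * (ϑ 𝒟 d s + 2)           ≤⟨ *-monoˡ-≤ (ϑ 𝒟 d s + 2) (eHeight-pos d) ⟩
    eHeight 𝒟 d * (ϑ 𝒟 d s + 2) ∎
    where open ≤-Reasoning

  -- A summand a ≤ t + 2 plus a product h·(u + 2) with h < H and u ≤ t
  -- fits into H·(t + 2); both components of ϑ after E d ⇒ R (E d') (E d'')
  -- have this shape.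
  E-budget : ∀ {x h H u t} → x ≤ t + 2 → h < H → u ≤ t → x + h * (u + 2) ≤ H * (t + 2)
  E-budget x≤ (s≤s h≤k) u≤t = +-mono-≤ x≤ (*-mono-≤ h≤k (+-monoˡ-≤ 2 u≤t))

  ϑ-mono : ∀ {d d'} → _⇒_ 𝒟 d d' → ϑ 𝒟 d' s ≤ ϑ 𝒟 d s
  ϑ-mono (base⇒ _)          = ≤-refl
  ϑ-mono (I⇒ p)             = +-monoˡ-≤ 1 (ϑ-mono p)
  ϑ-mono (E⇒ p)             = *-mono-≤ (<⇒≤ (⇒-height p)) (+-monoˡ-≤ 2 (ϑ-mono p))
  ϑ-mono (R⇒ {d} p)         = ⊔-monoˡ-≤ _ (+-monoʳ-≤ (eSize 𝒟 d + 1) (ϑ-mono p))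
  ϑ-mono RI⇒                = m≤n⊔m _ _
  ϑ-mono (ER⇒ {d} {d'} {d''} p q) = ⊔-lub left right
    where
    t : ℕ
    t = ϑ 𝒟 d s

    size-d'≤ : eSize 𝒟 d' + 1 + 1 ≤ t + 2
    size-d'≤ = subst (eSize 𝒟 d' + 1 + 1 ≤_) (+-assoc t 1 1)
      (+-monoˡ-≤ 1 (+-monoˡ-≤ 1 (≤-trans (eSize≤ϑ d') (ϑ-mono p))))

    left : eSize 𝒟 d' + 1 + 1 + eHeight 𝒟 d'' * (ϑ 𝒟 d'' s + 2) ≤ ϑ 𝒟 (E d) s
    left = E-budget {t = t} size-d'≤ (⇒-height q) (ϑ-mono q)

    right : eHeight 𝒟 d' * (ϑ 𝒟 d' s + 2) + 1 ≤ ϑ 𝒟 (E d) s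
    right = subst (_≤ ϑ 𝒟 (E d) s) (+-comm 1 (eHeight 𝒟 d' * (ϑ 𝒟 d' s + 2)))
      (E-budget {t = t} (≤-trans (s≤s z≤n) (m≤n+m 2 t)) (⇒-height p) (ϑ-mono p))

mainTheorem3 : ∀ {a r} (𝒟 : ProofNotations a r) (s : ℕ) → Bounded 𝒟 s →
    ∀ {d d' : Ecl 𝒟} → _⇒_ 𝒟 d d' → ϑ 𝒟 d s ≥ ϑ 𝒟 d' s
mainTheorem3 𝒟 s bounded = SizeFunctions.ϑ-mono 𝒟 s bounded
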